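{- Let $\mathbb{V}$ be an infinite dimensional vector space over a field $\mathbb{F}\neq\mathbb{F}_2$ and $\mathcal{K}=\{+\}\cup\{f_r:r\in\mathbb{F},r\neq0\}$, where $f_r(v)=r\cdot v$. Then $(\mathbb{V},\mathcal{K})$ is not a Ramsey algebra.
   Context: $\mathbb{F}_2$ is the two-element field. Orderly terms $\mathrm{OT}(\mathcal{K})$: smallest collection containing $\mathcal{K}$ and $\mathrm{id}_\mathbb{V}$, closed under $f(\bar x_1,\dots,\bar x_k)=g(h_1(\bar x_1),\dots,h_k(\bar x_k))$ for $k$-ary $g\in\mathcal{K}$, orderly terms $h_i$, consecutive disjoint variable blocks $\bar x_i$. For $\vec a,\vec b\in{}^\omega\mathbb{V}$, $\vec a\le_\mathcal{K}\vec b$ means there are orderly terms $f_j$ and finite subsequences $\vec b_j$ of $\vec b$ with $\vec a(j)=f_j(\bar b_j)$ for all $j\in\omega$ and $\vec b_0\ast\vec b_1\ast\cdots$ a subsequence of $\vec b$. $\mathrm{FR}_\mathcal{K}(\vec a)=\{f(\bar\tau):f\in\mathrm{OT}(\mathcal{K}),\ \vec\tau\text{ a finite subsequence of }\vec a\}$. $(\mathbb{V},\mathcal{K})$ is a Ramsey algebra if for every $\vec b\in{}^\omega\mathbb{V}$ and $X\subseteq\mathbb{V}$ there exists $\vec a\le_\mathcal{K}\vec b$ with $\mathrm{FR}_\mathcal{K}(\vec a)\subseteq X$ or $\mathrm{FR}_\mathcal{K}(\vec a)\cap X=\varnothing$. -}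

module Defs where

open import Level using (Level; _⊔_) renaming (suc to lsuc)
open import Data.Nat using (ℕ; zero; suc; _+_; _<_)
open import Data.Fin using (Fin; toℕ) renaming (zero to fzero; suc to fsuc)
open import Data.Vec using (Vec; []; _∷_; splitAt; tabulate)
open import Data.Product using (Σ; ∃; ∃-syntax; _×_; _,_)
open import Data.Sum using (_⊎_; inj₁; inj₂)
open import Data.Unit using (⊤; tt)
open import Relation.Nullary using (¬_)
open import Relation.Unary using (Pred)
open import Algebra.Bundles using (CommutativeRing)
open import Algebra.Module.Bundles using (Module)

IsField : ∀ {c ℓ} → CommutativeRing c ℓ → Set (c ⊔ ℓ)
IsField R = (¬ (1# ≈ 0#)) × (∀ x → ¬ (x ≈ 0#) → ∃[ y ] (x * y ≈ 1#))
  where open CommutativeRing R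

NotF₂ : ∀ {c ℓ} → CommutativeRing c ℓ → Set (c ⊔ ℓ)
NotF₂ R = ∃[ r ] ((¬ (r ≈ 0#)) × (¬ (r ≈ 1#)))
  where open CommutativeRing R

module _ {c ℓ m ℓm} {R : CommutativeRing c ℓ} (M : Module R m ℓm) where
  open CommutativeRing R
  open Module M

  linComb : ∀ {n} → (Fin n → Carrier) → (Fin n → Carrierᴹ) → Carrierᴹ
  linComb {zero}  c v = 0ᴹ
  linComb {suc n} c v = (c fzero *ₗ v fzero) +ᴹ linComb (λ i → c (fsuc i)) (λ i → v (fsuc i))

  FinitelySpanned : Set (c ⊔ m ⊔ ℓm)
  FinitelySpanned =
    ∃[ n ] Σ (Fin n → Carrierᴹ) λ v → ∀ x → ∃[ cs ] (x ≈ᴹ linComb cs v)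

  InfiniteDimensional : Set (c ⊔ m ⊔ ℓm)
  InfiniteDimensional = ¬ FinitelySpanned

record OpAlgebra (i v ℓv : Level) : Set (lsuc (i ⊔ v ⊔ ℓv)) where
  field
    Ops   : Set i
    arity : Ops → ℕ
    V     : Set v
    _≈_   : V → V → Set ℓv
    op    : (g : Ops) → Vec V (arity g) → V

module _ {i v ℓv} (A : OpAlgebra i v ℓv) where
  open OpAlgebra A

  -- Orderly terms OT(𝒦): id, and g(h₁,…,hₖ) for g ∈ 𝒦 and orderly h_j
  -- applied to consecutive disjoint variable blocks.
  mutual
    data OT : Set i where
      idT : OT
      app : (g : Ops) → OTs (arity g) → OT

    data OTs : ℕ → Set i where
      []  : OTs zero
      _∷_ : ∀ {n} → OT → OTs n → OTs (suc n)

  mutual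
    ar : OT → ℕ
    ar idT       = 1
    ar (app g hs) = ars hs

    ars : ∀ {n} → OTs n → ℕ
    ars []       = 0
    ars (h ∷ hs) = ar h + ars hs

  mutual
    eval : (t : OT) → Vec V (ar t) → V
    eval idT        (x ∷ []) = x
    eval (app g hs) xs       = op g (evals hs xs)

    evals : ∀ {n} (hs : OTs n) → Vec V (ars hs) → Vec V n
    evals []       _  = []
    evals (h ∷ hs) xs with splitAt (ar h) xs
    ... | ys , zs , _ = eval h ys ∷ evals hs zs

  Seq : Set v
  Seq = ℕ → V

  FinIncr : ∀ {n} → (Fin n → ℕ) → Set
  FinIncr τ = ∀ x y → toℕ x < toℕ y → τ x < τ y

  NatIncr : (ℕ → ℕ) → Set
  NatIncr σ = ∀ x y → x < y → σ x < σ y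

  blockStart : (ℕ → OT) → ℕ → ℕ
  blockStart f zero    = 0
  blockStart f (suc j) = blockStart f j + ar (f j)

  -- a ≤_𝒦 b : a(j) = f_j(b⃗_j) with b⃗₀ * b⃗₁ * ⋯ a subsequence b ∘ σ of b.
  _≤K_ : Seq → Seq → Set (i ⊔ ℓv)
  a ≤K b = Σ (ℕ → OT) λ f → Σ (ℕ → ℕ) λ σ → NatIncr σ ×
           (∀ j → a j ≈ eval (f j) (tabulate (λ k → b (σ (blockStart f j + toℕ k)))))

  _∈FR_ : V → Seq → Set (i ⊔ ℓv)
  x ∈FR a = Σ OT λ f → Σ (Fin (ar f) → ℕ) λ τ → FinIncr τ ×
            (x ≈ eval f (tabulate (λ k → a (τ k))))

  Respects : ∀ {p} → Pred V p → Set (v ⊔ ℓv ⊔ p)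
  Respects X = ∀ {x y} → x ≈ y → X x → X y

  IsRamseyAlgebra : (p : Level) → Set (i ⊔ v ⊔ ℓv ⊔ lsuc p)
  IsRamseyAlgebra p =
    (b : Seq) (X : Pred V p) → Respects X →
    ∃[ a ] (a ≤K b × ((∀ x → x ∈FR a → X x) ⊎ (∀ x → x ∈FR a → ¬ X x)))

module _ {c ℓ m ℓm} {R : CommutativeRing c ℓ} (M : Module R m ℓm) where
  open CommutativeRing R
  open Module M

  VSOps : Set (c ⊔ ℓ)
  VSOps = ⊤ ⊎ (Σ Carrier λ r → ¬ (r ≈ 0#))

  vsArity : VSOps → ℕ
  vsArity (inj₁ _) = 2
  vsArity (inj₂ _) = 1

  vsOp : (g : VSOps) → Vec Carrierᴹ (vsArity g) → Carrierᴹ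
  vsOp (inj₁ _)       (x ∷ y ∷ []) = x +ᴹ y
  vsOp (inj₂ (r , _)) (x ∷ [])     = r *ₗ x

  vectorSpaceAlgebra : OpAlgebra (c ⊔ ℓ) m ℓm
  vectorSpaceAlgebra = record
    { Ops = VSOps ; arity = vsArity ; V = Carrierᴹ ; _≈_ = _≈ᴹ_ ; op = vsOp }

-- A Ramsey algebra decides every proposition (colour all of 𝕍 by it), so in an infinite
-- dimensional space we may choose b₀, b₁, … with each bₙ outside the span of its predecessors.
-- A vector k bₙ + w with k ≠ 0 and w ∈ ⟨b₀, …, bₙ₋₁⟩ has the well-defined leading coefficient k;
-- colour x by "x has leading coefficient 1". If a ≤_𝒦 b, then a₀ is an orderly term in an
-- increasing block of the bᵢ, and since + only adds vectors spanned by earlier variables to the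
-- last one and f_s rescales by s ≠ 0, the last bᵢ of the block leads a₀ with some k ≠ 0. Then
-- k⁻¹a₀ and r k⁻¹a₀, for r ∉ {0, 1}, both lie in FR(a) and get different colours.

module Submission where

open import Level using (_⊔_; Lift; lift; lower)
open import Axiom.ExcludedMiddle using (ExcludedMiddle)
open import Algebra.Bundles using (CommutativeRing; CommutativeMonoid)
open import Algebra.Module.Bundles using (Module)
import Algebra.Properties.CommutativeSemigroup as CommutativeSemigroupProperties
import Algebra.Properties.Group as GroupProperties
import Algebra.Module.Properties.LeftModule as LeftModuleProperties
import Algebra.Properties.Ring as RingProperties
open import Data.Empty using (⊥-elim)
open import Data.Fin using (Fin; toℕ) renaming (zero to fzero; suc to fsuc)
open import Data.List as List using (List; []; _∷_; length)
open import Data.Nat using (ℕ; zero; suc; _<_; z≤n; s≤s; _≤′_; ≤′-refl; ≤′-step)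
open import Data.Nat.Properties using (<-cmp; ≤⇒≤′; m+n≡0⇒m≡0)
open import Data.Product using (∃; ∃-syntax; _×_; _,_; proj₁; proj₂; map₁)
open import Data.Sum using (_⊎_; inj₁; inj₂)
open import Data.Vec using (Vec; []; _∷_; _++_; splitAt; tabulate)
open import Data.Vec.Relation.Unary.All using (All; []; _∷_)
import Data.Vec.Relation.Unary.All.Properties as All
open import Relation.Binary.Definitions using (Reflexive; tri<; tri≈; tri>)
open import Relation.Binary.PropositionalEquality using (_≢_; refl)
import Relation.Binary.Reasoning.Setoid as SetoidReasoning
open import Relation.Nullary using (¬_; yes; no)
open import Relation.Nullary.Decidable using (map′)
open import Relation.Unary using (Pred)

open import Defs

ExcludedMiddle-lower : ∀ {a} b → ExcludedMiddle (a ⊔ b) → ExcludedMiddle a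
ExcludedMiddle-lower b em = map′ lower lift (em {Lift b _})

module _ {i v ℓv} (A : OpAlgebra i v ℓv) where
  open OpAlgebra A

  FR-Homogeneous : ∀ {p} → Pred V p → Seq A → Set (i ⊔ v ⊔ ℓv ⊔ p)
  FR-Homogeneous X a = (∀ x → _∈FR_ A x a → X x) ⊎ (∀ x → _∈FR_ A x a → ¬ X x)

  FinIncr-singleton : (τ : Fin 1 → ℕ) → FinIncr A τ
  FinIncr-singleton τ fzero fzero ()

  head∈FR : Reflexive _≈_ → (a : Seq A) → _∈FR_ A (a 0) a
  head∈FR ≈-refl a = idT , (λ _ → 0) , FinIncr-singleton _ , ≈-refl

  -- Homogeneity for the constant colouring by P decides P.
  ramsey⇒excludedMiddle : ∀ {p} → Reflexive _≈_ → V → IsRamseyAlgebra A p → ExcludedMiddle p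
  ramsey⇒excludedMiddle ≈-refl x ramsey {P} with ramsey (λ _ → x) (λ _ → P) (λ _ p → p)
  ... | a , _ , inj₁ all  = yes (all (a 0) (head∈FR ≈-refl a))
  ... | a , _ , inj₂ none = no (none (a 0) (head∈FR ≈-refl a))

  data LastIn {p q} (S : Pred V p) (T : Pred V q) : ∀ {n} → Vec V n → Set (v ⊔ p ⊔ q) where
    [_] : ∀ {x} → T x → LastIn S T (x ∷ [])
    _∷_ : ∀ {x n} {xs : Vec V n} → S x → LastIn S T xs → LastIn S T (x ∷ xs)

  module _ {p q} {S : Pred V p} {T : Pred V q} where

    LastIn-++⁻ : ∀ {m n} (xs : Vec V m) {ys : Vec V n} → n ≢ 0 →
                 LastIn S T (xs ++ ys) → All S xs × LastIn S T ys
    LastIn-++⁻ []            _          l       = [] , l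
    LastIn-++⁻ (x ∷ [])      {[]}    n≢0 _      = ⊥-elim (n≢0 refl)
    LastIn-++⁻ (x ∷ [])      {_ ∷ _} _   (s ∷ l) = s ∷ [] , l
    LastIn-++⁻ (x ∷ x′ ∷ xs) n≢0        (s ∷ l) = map₁ (s ∷_) (LastIn-++⁻ (x′ ∷ xs) n≢0 l)

    LastIn-++[]⁻ : ∀ {m} (xs : Vec V m) → LastIn S T (xs ++ []) → LastIn S T xs
    LastIn-++[]⁻ (x ∷ [])      l       = l
    LastIn-++[]⁻ (x ∷ x′ ∷ xs) (s ∷ l) = s ∷ LastIn-++[]⁻ (x′ ∷ xs) l

  module _ (arity≢0 : ∀ g → arity g ≢ 0) where
    mutual
      ar≢0 : ∀ t → ar A t ≢ 0
      ar≢0 idT        ()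
      ar≢0 (app g hs) = ars≢0 hs (arity≢0 g)

      ars≢0 : ∀ {n} (hs : OTs A n) → n ≢ 0 → ars A hs ≢ 0
      ars≢0 []       n≢0 = ⊥-elim (n≢0 refl)
      ars≢0 (h ∷ hs) _   = λ e → ar≢0 h (m+n≡0⇒m≡0 (ar A h) e)

  module _ {p} {S : Pred V p} (op-All : ∀ g {xs} → All S xs → S (op g xs)) where
    mutual
      eval-All : ∀ t {xs} → All S xs → S (eval A t xs)
      eval-All idT        (s ∷ []) = s
      eval-All (app g hs) ss       = op-All g (evals-All hs ss)

      evals-All : ∀ {n} (hs : OTs A n) {xs} → All S xs → All S (evals A hs xs)
      evals-All []       _ = []
      evals-All (h ∷ hs) {xs} ss with splitAt (ar A h) xs
      ... | ys , zs , refl = let (ss₁ , ss₂) = All.++⁻ ys ss in eval-All h ss₁ ∷ evals-All hs ss₂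

    -- The last variable of an orderly term lies in the last argument block of its outermost operation.
    module _ {q} {T : Pred V q} (arity≢0 : ∀ g → arity g ≢ 0)
             (op-LastIn : ∀ g {xs} → LastIn S T xs → T (op g xs)) where
      mutual
        eval-LastIn : ∀ t {xs} → LastIn S T xs → T (eval A t xs)
        eval-LastIn idT        [ t ] = t
        eval-LastIn (app g hs) l     = op-LastIn g (evals-LastIn hs (arity≢0 g) l)

        evals-LastIn : ∀ {n} (hs : OTs A n) → n ≢ 0 → ∀ {xs} → LastIn S T xs → LastIn S T (evals A hs xs)
        evals-LastIn []       n≢0 _ = ⊥-elim (n≢0 refl)
        evals-LastIn (h ∷ hs) _ {xs} l with splitAt (ar A h) xs
        evals-LastIn (h ∷ []) _ l | ys , [] , refl = [ eval-LastIn h (LastIn-++[]⁻ ys l) ]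
        evals-LastIn (h ∷ hs@(_ ∷ _)) _ l | ys , zs , refl =
          let (ss , l′) = LastIn-++⁻ ys (ars≢0 arity≢0 hs (λ ())) l
          in eval-All h ss ∷ evals-LastIn hs (λ ()) l′

module Field {c ℓ} {F : CommutativeRing c ℓ} (isField : IsField F) where
  open CommutativeRing F

  1≉0 : 1# ≉ 0#
  1≉0 = proj₁ isField

  ≈1⇒≉0 : ∀ {x} → x ≈ 1# → x ≉ 0#
  ≈1⇒≉0 x≈1 x≈0 = 1≉0 (trans (sym x≈1) x≈0)

  inverseˡ : ∀ x → x ≉ 0# → ∃[ y ] (y * x ≈ 1#)
  inverseˡ x x≉0 = let (y , xy≈1) = proj₂ isField x x≉0 in y , trans (*-comm y x) xy≈1

  inverse-nonzero : ∀ {x y} → y * x ≈ 1# → y ≉ 0#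
  inverse-nonzero {x} yx≈1 y≈0 = ≈1⇒≉0 yx≈1 (trans (*-congʳ y≈0) (zeroˡ x))

  *-nonzero : ∀ {x y} → x ≉ 0# → y ≉ 0# → x * y ≉ 0#
  *-nonzero {x} {y} x≉0 y≉0 xy≈0 with inverseˡ x x≉0
  ... | x⁻¹ , x⁻¹x≈1 = y≉0 (begin
    y               ≈⟨ sym (*-identityˡ y) ⟩
    1# * y          ≈⟨ *-congʳ (sym x⁻¹x≈1) ⟩
    (x⁻¹ * x) * y   ≈⟨ *-assoc x⁻¹ x y ⟩
    x⁻¹ * (x * y)   ≈⟨ *-congˡ xy≈0 ⟩
    x⁻¹ * 0#        ≈⟨ zeroʳ x⁻¹ ⟩
    0#              ∎)
    where open SetoidReasoning setoid

module _ {c ℓ m ℓm} {F : CommutativeRing c ℓ} (V : Module F m ℓm) where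
  open CommutativeRing F
    using (_≈_; _≉_; _+_; _*_; -_; 0#; 1#; -‿inverseʳ; *-assoc; *-congˡ; *-identityʳ; +-congˡ; +-group; ring)
    renaming (Carrier to Scalar; refl to ≈-refl; sym to ≈-sym; trans to ≈-trans)
  open Module V
  open SetoidReasoning ≈ᴹ-setoid
  open CommutativeSemigroupProperties (CommutativeMonoid.commutativeSemigroup +ᴹ-commutativeMonoid)
    using (interchange)

  +ᴹ-combine : ∀ k k′ v w w′ → (k *ₗ v +ᴹ w) +ᴹ (k′ *ₗ v +ᴹ w′) ≈ᴹ (k + k′) *ₗ v +ᴹ (w +ᴹ w′)
  +ᴹ-combine k k′ v w w′ = begin
    (k *ₗ v +ᴹ w) +ᴹ (k′ *ₗ v +ᴹ w′)  ≈⟨ interchange _ _ _ _ ⟩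
    (k *ₗ v +ᴹ k′ *ₗ v) +ᴹ (w +ᴹ w′)  ≈⟨ +ᴹ-congʳ (*ₗ-distribʳ v k k′) ⟨
    (k + k′) *ₗ v +ᴹ (w +ᴹ w′)        ∎

  *ₗ-combine : ∀ s k v w → s *ₗ (k *ₗ v +ᴹ w) ≈ᴹ (s * k) *ₗ v +ᴹ s *ₗ w
  *ₗ-combine s k v w = begin
    s *ₗ (k *ₗ v +ᴹ w)       ≈⟨ *ₗ-distribˡ s (k *ₗ v) w ⟩
    s *ₗ (k *ₗ v) +ᴹ s *ₗ w  ≈⟨ +ᴹ-congʳ (*ₗ-assoc s k v) ⟨
    (s * k) *ₗ v +ᴹ s *ₗ w   ∎

  -ᴹ≈-1*ₗ : ∀ x → -ᴹ x ≈ᴹ (- 1#) *ₗ x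
  -ᴹ≈-1*ₗ x = ≈ᴹ-sym (LeftModuleProperties.inverseʳ-uniqueᴹ leftModule x ((- 1#) *ₗ x) (begin
    x +ᴹ (- 1#) *ₗ x          ≈⟨ +ᴹ-congʳ (*ₗ-identityˡ x) ⟨
    1# *ₗ x +ᴹ (- 1#) *ₗ x    ≈⟨ *ₗ-distribʳ x 1# (- 1#) ⟨
    (1# + - 1#) *ₗ x          ≈⟨ *ₗ-congʳ (-‿inverseʳ 1#) ⟩
    0# *ₗ x                   ≈⟨ *ₗ-zeroˡ x ⟩
    0ᴹ                        ∎))

  data InSpan : List Carrierᴹ → Carrierᴹ → Set (c ⊔ m ⊔ ℓm) where
    span[] : ∀ {x} → x ≈ᴹ 0ᴹ → InSpan [] x
    span∷  : ∀ {v vs x} k w → InSpan vs w → x ≈ᴹ k *ₗ v +ᴹ w → InSpan (v ∷ vs) x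

  InSpan-resp : ∀ {vs x y} → x ≈ᴹ y → InSpan vs x → InSpan vs y
  InSpan-resp x≈y (span[] x≈0)       = span[] (≈ᴹ-trans (≈ᴹ-sym x≈y) x≈0)
  InSpan-resp x≈y (span∷ k w span e) = span∷ k w span (≈ᴹ-trans (≈ᴹ-sym x≈y) e)

  InSpan-0ᴹ : ∀ vs → InSpan vs 0ᴹ
  InSpan-0ᴹ []       = span[] ≈ᴹ-refl
  InSpan-0ᴹ (v ∷ vs) = span∷ 0# 0ᴹ (InSpan-0ᴹ vs) (begin
    0ᴹ               ≈⟨ *ₗ-zeroˡ v ⟨
    0# *ₗ v          ≈⟨ +ᴹ-identityʳ _ ⟨
    0# *ₗ v +ᴹ 0ᴹ    ∎)

  InSpan-+ᴹ : ∀ {vs x y} → InSpan vs x → InSpan vs y → InSpan vs (x +ᴹ y)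
  InSpan-+ᴹ (span[] x≈0) (span[] y≈0) = span[] (≈ᴹ-trans (+ᴹ-cong x≈0 y≈0) (+ᴹ-identityˡ 0ᴹ))
  InSpan-+ᴹ (span∷ k w p e) (span∷ k′ w′ p′ e′) =
    span∷ (k + k′) (w +ᴹ w′) (InSpan-+ᴹ p p′) (≈ᴹ-trans (+ᴹ-cong e e′) (+ᴹ-combine k k′ _ w w′))

  InSpan-*ₗ : ∀ {vs x} s → InSpan vs x → InSpan vs (s *ₗ x)
  InSpan-*ₗ s (span[] x≈0)    = span[] (≈ᴹ-trans (*ₗ-congˡ x≈0) (*ₗ-zeroʳ s))
  InSpan-*ₗ s (span∷ k w p e) = span∷ (s * k) (s *ₗ w) (InSpan-*ₗ s p) (≈ᴹ-trans (*ₗ-congˡ e) (*ₗ-combine s k _ w))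

  InSpan-neg : ∀ {vs x} → InSpan vs x → InSpan vs (-ᴹ x)
  InSpan-neg p = InSpan-resp (≈ᴹ-sym (-ᴹ≈-1*ₗ _)) (InSpan-*ₗ (- 1#) p)

  InSpan-weaken : ∀ {v vs x} → InSpan vs x → InSpan (v ∷ vs) x
  InSpan-weaken {v} {x = x} p = span∷ 0# x p (begin
    x                ≈⟨ +ᴹ-identityˡ x ⟨
    0ᴹ +ᴹ x          ≈⟨ +ᴹ-congʳ (*ₗ-zeroˡ v) ⟨
    0# *ₗ v +ᴹ x     ∎)

  InSpan⇒linComb : ∀ {vs x} → InSpan vs x → ∃[ cs ] (x ≈ᴹ linComb V cs (List.lookup vs))
  InSpan⇒linComb (span[] x≈0)    = (λ ()) , x≈0
  InSpan⇒linComb (span∷ k w p e) with InSpan⇒linComb p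
  ... | cs , w≈ = (λ { fzero → k ; (fsuc i) → cs i }) , ≈ᴹ-trans e (+ᴹ-congˡ w≈)

  InCoset : Scalar → Carrierᴹ → List Carrierᴹ → Carrierᴹ → Set (c ⊔ m ⊔ ℓm)
  InCoset k v vs x = ∃[ w ] (InSpan vs w × x ≈ᴹ k *ₗ v +ᴹ w)

  module _ {v : Carrierᴹ} {vs : List Carrierᴹ} where

    InCoset-resp : ∀ {k x y} → x ≈ᴹ y → InCoset k v vs x → InCoset k v vs y
    InCoset-resp x≈y (w , p , e) = w , p , ≈ᴹ-trans (≈ᴹ-sym x≈y) e

    InCoset⇒InSpan : ∀ {k x} → InCoset k v vs x → InSpan (v ∷ vs) x
    InCoset⇒InSpan {k} (w , p , e) = span∷ k w p e

    InCoset-self : InCoset 1# v vs v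
    InCoset-self = 0ᴹ , InSpan-0ᴹ vs , (begin
      v                ≈⟨ *ₗ-identityˡ v ⟨
      1# *ₗ v          ≈⟨ +ᴹ-identityʳ _ ⟨
      1# *ₗ v +ᴹ 0ᴹ    ∎)

    InSpan-here : InSpan (v ∷ vs) v
    InSpan-here = InCoset⇒InSpan InCoset-self

    InCoset-+ᴹ : ∀ {k k′ x y} → InCoset k v vs x → InCoset k′ v vs y → InCoset (k + k′) v vs (x +ᴹ y)
    InCoset-+ᴹ {k} {k′} (w , p , e) (w′ , p′ , e′) =
      w +ᴹ w′ , InSpan-+ᴹ p p′ , ≈ᴹ-trans (+ᴹ-cong e e′) (+ᴹ-combine k k′ v w w′)

    InCoset-*ₗ : ∀ {k x} s → InCoset k v vs x → InCoset (s * k) v vs (s *ₗ x)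
    InCoset-*ₗ {k} s (w , p , e) = s *ₗ w , InSpan-*ₗ s p , ≈ᴹ-trans (*ₗ-congˡ e) (*ₗ-combine s k v w)

    InCoset-neg : ∀ {k x} → InCoset k v vs x → InCoset (- 1# * k) v vs (-ᴹ x)
    InCoset-neg p = InCoset-resp (≈ᴹ-sym (-ᴹ≈-1*ₗ _)) (InCoset-*ₗ (- 1#) p)

    InCoset-+InSpan : ∀ {k x y} → InSpan vs y → InCoset k v vs x → InCoset k v vs (y +ᴹ x)
    InCoset-+InSpan {k} {x} {y} q (w , p , e) = w +ᴹ y , InSpan-+ᴹ p q , (begin
      y +ᴹ x                  ≈⟨ +ᴹ-comm y x ⟩
      x +ᴹ y                  ≈⟨ +ᴹ-congʳ e ⟩
      (k *ₗ v +ᴹ w) +ᴹ y      ≈⟨ +ᴹ-assoc _ w y ⟩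
      k *ₗ v +ᴹ (w +ᴹ y)      ∎)

    InCoset-InSpan⇒InSpan : ∀ {k k⁻¹ x} → k⁻¹ * k ≈ 1# → InCoset k v vs x → InSpan vs x → InSpan vs v
    InCoset-InSpan⇒InSpan {k} {k⁻¹} {x} k⁻¹k≈1 (w , p , e) q =
      InSpan-resp v≈ (InSpan-*ₗ k⁻¹ (InSpan-+ᴹ q (InSpan-neg p)))
      where
      v≈ : k⁻¹ *ₗ (x +ᴹ -ᴹ w) ≈ᴹ v
      v≈ = begin
        k⁻¹ *ₗ (x +ᴹ -ᴹ w)               ≈⟨ *ₗ-congˡ (+ᴹ-congʳ e) ⟩
        k⁻¹ *ₗ ((k *ₗ v +ᴹ w) +ᴹ -ᴹ w)   ≈⟨ *ₗ-congˡ (+ᴹ-assoc _ w (-ᴹ w)) ⟩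
        k⁻¹ *ₗ (k *ₗ v +ᴹ (w +ᴹ -ᴹ w))   ≈⟨ *ₗ-congˡ (+ᴹ-congˡ (-ᴹ‿inverseʳ w)) ⟩
        k⁻¹ *ₗ (k *ₗ v +ᴹ 0ᴹ)            ≈⟨ *ₗ-congˡ (+ᴹ-identityʳ _) ⟩
        k⁻¹ *ₗ (k *ₗ v)                  ≈⟨ *ₗ-assoc k⁻¹ k v ⟨
        (k⁻¹ * k) *ₗ v                   ≈⟨ *ₗ-congʳ k⁻¹k≈1 ⟩
        1# *ₗ v                          ≈⟨ *ₗ-identityˡ v ⟩
        v                                ∎

  excludedMiddle⇒∉span : ExcludedMiddle (c ⊔ m ⊔ ℓm) → InfiniteDimensional V →
                         ∀ vs → ∃[ x ] ¬ InSpan vs x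
  excludedMiddle⇒∉span em infinite vs with em {∃[ x ] ¬ InSpan vs x}
  ... | yes found = found
  ... | no none   = ⊥-elim (infinite (length vs , List.lookup vs , λ x → InSpan⇒linComb (spans x)))
    where
    spans : ∀ x → InSpan vs x
    spans x with em {InSpan vs x}
    ... | yes x∈ = x∈
    ... | no x∉  = ⊥-elim (none (x , x∉))

  𝒱 : OpAlgebra (c ⊔ ℓ) m ℓm
  𝒱 = vectorSpaceAlgebra V

  vsOp-InSpan : ∀ {vs} g {xs} → All (InSpan vs) xs → InSpan vs (vsOp V g xs)
  vsOp-InSpan (inj₁ _)       (p ∷ q ∷ []) = InSpan-+ᴹ p q
  vsOp-InSpan (inj₂ (s , _)) (p ∷ [])     = InSpan-*ₗ s p

  vsArity≢0 : ∀ g → vsArity V g ≢ 0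
  vsArity≢0 (inj₁ _) ()
  vsArity≢0 (inj₂ _) ()

  scaledHead∈FR : (a : Seq 𝒱) (s : Scalar) (s≉0 : s ≉ 0#) →
                  _∈FR_ 𝒱 (s *ₗ a 0) a
  scaledHead∈FR a s s≉0 =
    app (inj₂ (s , s≉0)) (idT ∷ []) , (λ _ → 0) , FinIncr-singleton 𝒱 _ , ≈ᴹ-refl

  module AvoidingSequence (isField : IsField F) (∉span : ∀ vs → ∃[ x ] ¬ InSpan vs x) where
    open Field {F = F} isField

    mutual
      prefix : ℕ → List Carrierᴹ
      prefix zero    = []
      prefix (suc n) = b n ∷ prefix n

      b : ℕ → Carrierᴹ
      b n = proj₁ (∉span (prefix n))

    b∉prefix : ∀ n → ¬ InSpan (prefix n) (b n)
    b∉prefix n = proj₂ (∉span (prefix n))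

    prefix-mono : ∀ {n k x} → n ≤′ k → InSpan (prefix n) x → InSpan (prefix k) x
    prefix-mono ≤′-refl        p = p
    prefix-mono (≤′-step n≤′k) p = InSpan-weaken (prefix-mono n≤′k p)

    b∈prefix : ∀ {i n} → i < n → InSpan (prefix n) (b i)
    b∈prefix i<n = prefix-mono (≤⇒≤′ i<n) InSpan-here

    LeadingAt : ℕ → Scalar → Carrierᴹ → Set (c ⊔ m ⊔ ℓm)
    LeadingAt n k = InCoset k (b n) (prefix n)

    LeadingAt-∉prefix : ∀ {n k x} → k ≉ 0# → LeadingAt n k x → ¬ InSpan (prefix n) x
    LeadingAt-∉prefix {n} {k} k≉0 lead x∈ =
      let (k⁻¹ , k⁻¹k≈1) = inverseˡ k k≉0 in b∉prefix n (InCoset-InSpan⇒InSpan k⁻¹k≈1 lead x∈)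

    LeadingAt-unique : ∀ {n j k k′ x} → k ≉ 0# → k′ ≉ 0# →
                       LeadingAt n k x → LeadingAt j k′ x → ¬ ¬ (k ≈ k′)
    LeadingAt-unique {n} {j} {k} {k′} {x} k≉0 k′≉0 lead lead′ with <-cmp n j
    ... | tri< n<j _ _ = ⊥-elim (LeadingAt-∉prefix k′≉0 lead′ (prefix-mono (≤⇒≤′ n<j) (InCoset⇒InSpan lead)))
    ... | tri> _ _ j<n = ⊥-elim (LeadingAt-∉prefix k≉0 lead (prefix-mono (≤⇒≤′ j<n) (InCoset⇒InSpan lead′)))
    -- Otherwise 0ᴹ ≈ x - x would have the nonzero leading coefficient k - k′.
    ... | tri≈ _ refl _ = λ k≉k′ →
      LeadingAt-∉prefix (difference≉0 k≉k′) (InCoset-+ᴹ lead (InCoset-neg lead′))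
        (InSpan-resp (≈ᴹ-sym (-ᴹ‿inverseʳ x)) (InSpan-0ᴹ _))
      where
      difference≉0 : k ≉ k′ → k + - 1# * k′ ≉ 0#
      difference≉0 k≉k′ e = k≉k′ (GroupProperties.x∙y⁻¹≈ε⇒x≈y +-group k k′
        (≈-trans (+-congˡ (≈-sym (RingProperties.-1*x≈-x ring k′))) e))

    Leading : ℕ → Carrierᴹ → Set (c ⊔ ℓ ⊔ m ⊔ ℓm)
    Leading n x = ∃[ k ] (k ≉ 0# × LeadingAt n k x)

    Leading-resp : ∀ {n x y} → x ≈ᴹ y → Leading n x → Leading n y
    Leading-resp x≈y (k , k≉0 , lead) = k , k≉0 , InCoset-resp x≈y lead

    vsOp-Leading : ∀ {n} g {xs} → LastIn 𝒱 (InSpan (prefix n)) (Leading n) xs → Leading n (vsOp V g xs)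
    vsOp-Leading (inj₁ _)         (p ∷ [ k , k≉0 , lead ]) = k , k≉0 , InCoset-+InSpan p lead
    vsOp-Leading (inj₂ (s , s≉0)) [ k , k≉0 , lead ]       = s * k , *-nonzero s≉0 k≉0 , InCoset-*ₗ s lead

    tabulate-LastIn : ∀ {σ} → NatIncr 𝒱 σ → ∀ k →
      LastIn 𝒱 (InSpan (prefix (σ k))) (Leading (σ k)) (tabulate {n = suc k} (λ i → b (σ (toℕ i))))
    tabulate-LastIn σ-incr zero    = [ 1# , 1≉0 , InCoset-self ]
    tabulate-LastIn σ-incr (suc k) =
      b∈prefix (σ-incr 0 (suc k) (s≤s z≤n)) ∷ tabulate-LastIn (λ x y x<y → σ-incr (suc x) (suc y) (s≤s x<y)) k

    tabulate-∃LastIn : ∀ {σ} → NatIncr 𝒱 σ → ∀ {N} → N ≢ 0 →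
      ∃[ j ] LastIn 𝒱 (InSpan (prefix j)) (Leading j) (tabulate {n = N} (λ i → b (σ (toℕ i))))
    tabulate-∃LastIn σ-incr {zero}  N≢0 = ⊥-elim (N≢0 refl)
    tabulate-∃LastIn σ-incr {suc k} _   = _ , tabulate-LastIn σ-incr k

    ≤K⇒head-Leading : ∀ {a} → _≤K_ 𝒱 a b → ∃[ j ] Leading j (a 0)
    ≤K⇒head-Leading (f , σ , σ-incr , a≈) =
      let (j , l) = tabulate-∃LastIn σ-incr (ar≢0 𝒱 vsArity≢0 (f 0))
      in j , Leading-resp (≈ᴹ-sym (a≈ 0)) (eval-LastIn 𝒱 vsOp-InSpan vsArity≢0 vsOp-Leading (f 0) l)

    HasUnitLeading : Pred Carrierᴹ (c ⊔ ℓ ⊔ m ⊔ ℓm)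
    HasUnitLeading x = ∃[ n ] ∃[ k ] (k ≈ 1# × LeadingAt n k x)

    HasUnitLeading-resp : Respects 𝒱 HasUnitLeading
    HasUnitLeading-resp x≈y (n , k , k≈1 , lead) = n , k , k≈1 , InCoset-resp x≈y lead

    head-Leading⇒¬FR-Homogeneous : NotF₂ F → ∀ {a j} → Leading j (a 0) →
                                   ¬ FR-Homogeneous 𝒱 HasUnitLeading a
    head-Leading⇒¬FR-Homogeneous (r , r≉0 , r≉1) {a} {j} (k , k≉0 , lead) with inverseˡ k k≉0
    ... | k⁻¹ , k⁻¹k≈1 = refute
      where
      k⁻¹≉0 : k⁻¹ ≉ 0#
      k⁻¹≉0 = inverse-nonzero k⁻¹k≈1
      rk⁻¹≉0 : r * k⁻¹ ≉ 0#
      rk⁻¹≉0 = *-nonzero r≉0 k⁻¹≉0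
      rk⁻¹k≈r : (r * k⁻¹) * k ≈ r
      rk⁻¹k≈r = ≈-trans (*-assoc r k⁻¹ k) (≈-trans (*-congˡ k⁻¹k≈1) (*-identityʳ r))
      refute : ¬ FR-Homogeneous 𝒱 HasUnitLeading a
      refute (inj₂ ⊆∁X) = ⊆∁X (k⁻¹ *ₗ a 0) (scaledHead∈FR a k⁻¹ k⁻¹≉0) (j , k⁻¹ * k , k⁻¹k≈1 , InCoset-*ₗ k⁻¹ lead)
      refute (inj₁ ⊆X)  =
        let (n , k₁ , k₁≈1 , lead₁) = ⊆X ((r * k⁻¹) *ₗ a 0) (scaledHead∈FR a (r * k⁻¹) rk⁻¹≉0)
        in LeadingAt-unique (≈1⇒≉0 k₁≈1) (*-nonzero rk⁻¹≉0 k≉0) lead₁ (InCoset-*ₗ (r * k⁻¹) lead)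
             λ k₁≈rk⁻¹k → r≉1 (≈-trans (≈-sym rk⁻¹k≈r) (≈-trans (≈-sym k₁≈rk⁻¹k) k₁≈1))

theorem7p4 : ∀ {c ℓ m ℓm} (F : CommutativeRing c ℓ) (V : Module F m ℓm) →
    IsField F → NotF₂ F → InfiniteDimensional V →
    ¬ IsRamseyAlgebra (vectorSpaceAlgebra V) (c ⊔ ℓ ⊔ m ⊔ ℓm)
theorem7p4 {c} {ℓ} {m} {ℓm} F V isField notF₂ infinite ramsey =
  let (a , a≤b , homogeneous) = ramsey b HasUnitLeading HasUnitLeading-resp
      (_ , lead)              = ≤K⇒head-Leading a≤b
  in head-Leading⇒¬FR-Homogeneous notF₂ {a} lead homogeneous
  where
  open Module V using (0ᴹ; ≈ᴹ-refl)
  em : ExcludedMiddle (c ⊔ m ⊔ ℓm)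
  em = ExcludedMiddle-lower ℓ (ramsey⇒excludedMiddle (vectorSpaceAlgebra V) ≈ᴹ-refl 0ᴹ ramsey)
  open AvoidingSequence V isField (excludedMiddle⇒∉span V em infinite)
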